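{- Let $c>0$ and let $f\colon \mathbb{N}\to\mathbb{Z}$ be a function with $0\le f(k)\le ck$ for all positive integers $k$. Then for every real $x>0$, $$x-\#\{n\le x:\ n=k+f(k)\text{ for some positive integer }k\}\ \ge\ \frac{1}{(2c+2)x}\sum_{k\le x}f(k),$$ where $n$ and $k$ range over positive integers.
   Context: $\mathbb{N}=\{1,2,3,\dots\}$.
   Formalization: The variable x ranges over the positive rationals instead of the positive reals, and the constant c is likewise taken to be rational. -}

module Defs where

open import Data.Nat as ℕ using (ℕ; zero; suc)
open import Data.Integer as ℤ using (ℤ; +_)
open import Data.Rational as ℚ using (ℚ)
open import Data.List using (List; filter; length; upTo; map; foldr)
open import Data.List.Relation.Unary.Any using (Any; any?)
open import Relation.Binary.PropositionalEquality using (_≡_)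
import Data.Integer.Properties as ℤP

[1‥_] : ℕ → List ℕ
[1‥ N ] = map suc (upTo N)

-- ⌊ x ⌋ as a natural number (for x > 0 the floor is ≥ 0)
⌊_⌋ℕ : ℚ → ℕ
⌊ x ⌋ℕ = ℤ.∣ ℚ.floor x ∣

count : (ℕ → ℤ) → ℕ → ℕ
count f N = length (filter (λ n → any? (λ k → + n ℤP.≟ + k ℤ.+ f k) [1‥ N ]) [1‥ N ])

sumF : (ℕ → ℤ) → ℕ → ℤ
sumF f N = foldr ℤ._+_ (+ 0) (map f [1‥ N ])

ℤ→ℚ : ℤ → ℚ
ℤ→ℚ z = z ℚ./ 1

{-# OPTIONS --safe #-}
-- Let N = ⌊x⌋ and say that k ≤ m is pending at m when k + f(k) > m. Going from m to m + 1, a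
-- hit at m + 1 (a value k + f(k)) comes from k = m + 1, which then has f(k) = 0 and does not become
-- pending, or from an earlier k, which stops being pending; hence (hits in [1, m]) + (pending at m)
-- ≤ m. As at most N − m hits lie in (m, N], at most M := N − count of the k are pending at any
-- m ≤ N. Split f(k) = min(N − k, f(k)) + excess: the first parts add up to the number of pairs
-- k ≤ m < N with k pending at m, at most N·M; the excess vanishes unless k is pending at N, and it
-- is at most max f ≤ cN. So ∑ f(k) ≤ M(N + cN) ≤ (x − count)(2c + 2)x.
module Submission where

open import Defs

module Counting where

  open import Data.Bool using (true; false; if_then_else_)
  open import Data.Integer as ℤ using (ℤ)
  import Data.Integer.Properties as ℤ
  open import Data.List using ([]; _∷_; _++_; [_]; filter; length; map; foldr; upTo)
  open import Data.List.Properties using (upTo-∷ʳ; map-++; filter-++; length-++; foldr-++)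
  open import Data.List.Relation.Unary.Any using (Any; any?; satisfied)
  open import Data.List.Relation.Unary.Any.Properties using (map⁻)
  open import Data.Nat
  open import Data.Nat.Properties
  open import Algebra.Properties.CommutativeSemigroup +-commutativeSemigroup
    using (xy∙z≈xz∙y; x∙yz≈y∙zx) renaming (interchange to +-interchange)
  open import Data.Product using (∃-syntax; _,_)
  open import Data.Sum using (_⊎_; inj₁; inj₂)
  open import Function using (_∘_)
  open import Level using (0ℓ)
  open import Relation.Binary.PropositionalEquality hiding ([_])
  open import Relation.Nullary using (Dec; _because_; does; yes; no)
  open import Relation.Nullary.Decidable using (dec-true)
  open import Relation.Unary using (Pred; Decidable)

  -- Defined through does, so that 𝟙 (m <? n) and 𝟙 (m ≟ n) compute on suc m and suc n.
  𝟙 : {A : Set} → Dec A → ℕ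
  𝟙 a? = if does a? then 1 else 0

  𝟙≤1 : {A : Set} (a? : Dec A) → 𝟙 a? ≤ 1
  𝟙≤1 (true because _) = s≤s z≤n
  𝟙≤1 (false because _) = z≤n

  𝟙-yes : {A : Set} (a? : Dec A) → A → 𝟙 a? ≡ 1
  𝟙-yes a? a = cong (if_then 1 else 0) (dec-true a? a)

  1+m⊓n≡m⊓n+[m<n] : ∀ m n → suc m ⊓ n ≡ m ⊓ n + 𝟙 (m <? n)
  1+m⊓n≡m⊓n+[m<n] zero zero = refl
  1+m⊓n≡m⊓n+[m<n] (suc m) zero = refl
  1+m⊓n≡m⊓n+[m<n] zero (suc n) = refl
  1+m⊓n≡m⊓n+[m<n] (suc m) (suc n) = cong suc (1+m⊓n≡m⊓n+[m<n] m n)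

  [m<n]≡[1+m<n]+[n≡1+m] : ∀ m n → 𝟙 (m <? n) ≡ 𝟙 (suc m <? n) + 𝟙 (n ≟ suc m)
  [m<n]≡[1+m<n]+[n≡1+m] m zero = refl
  [m<n]≡[1+m<n]+[n≡1+m] zero (suc zero) = refl
  [m<n]≡[1+m<n]+[n≡1+m] zero (suc (suc n)) = refl
  [m<n]≡[1+m<n]+[n≡1+m] (suc m) (suc n) = [m<n]≡[1+m<n]+[n≡1+m] m n

  m≤o⇒m∸n≤[n<m]*o : ∀ {m n o} → m ≤ o → m ∸ n ≤ 𝟙 (n <? m) * o
  m≤o⇒m∸n≤[n<m]*o {zero} {n} _ = ≤-reflexive (0∸n≡0 n)
  m≤o⇒m∸n≤[n<m]*o {suc m} {zero} {o} m≤o = ≤-trans m≤o (≤-reflexive (sym (*-identityˡ o)))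
  m≤o⇒m∸n≤[n<m]*o {suc m} {suc n} m≤o = m≤o⇒m∸n≤[n<m]*o {m} {n} (<⇒≤ m≤o)

  ∑ : ℕ → (ℕ → ℕ) → ℕ
  ∑ zero h = 0
  ∑ (suc n) h = ∑ n h + h (suc n)

  syntax ∑ n (λ k → e) = ∑[ k ≤ n ] e

  max : ℕ → (ℕ → ℕ) → ℕ
  max zero h = 0
  max (suc n) h = max n h ⊔ h (suc n)

  syntax max n (λ k → e) = max[ k ≤ n ] e

  module _ {h h′ : ℕ → ℕ} where

    ∑-cong : ∀ n → (∀ {k} → 1 ≤ k → k ≤ n → h k ≡ h′ k) → ∑ n h ≡ ∑ n h′
    ∑-cong zero _ = refl
    ∑-cong (suc n) h≡h′ = cong₂ _+_ (∑-cong n λ 1≤k k≤n → h≡h′ 1≤k (m≤n⇒m≤1+n k≤n)) (h≡h′ (s≤s z≤n) ≤-refl)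

    ∑-mono-≤ : ∀ n → (∀ {k} → 1 ≤ k → k ≤ n → h k ≤ h′ k) → ∑ n h ≤ ∑ n h′
    ∑-mono-≤ zero _ = z≤n
    ∑-mono-≤ (suc n) h≤h′ = +-mono-≤ (∑-mono-≤ n λ 1≤k k≤n → h≤h′ 1≤k (m≤n⇒m≤1+n k≤n)) (h≤h′ (s≤s z≤n) ≤-refl)

    ∑-distrib-+ : ∀ n → ∑[ k ≤ n ] (h k + h′ k) ≡ ∑ n h + ∑ n h′
    ∑-distrib-+ zero = refl
    ∑-distrib-+ (suc n) = trans (cong (_+ (h (suc n) + h′ (suc n))) (∑-distrib-+ n)) (+-interchange (∑ n h) (∑ n h′) _ _)

  ∑-distribʳ-* : ∀ (h : ℕ → ℕ) c n → ∑[ k ≤ n ] (h k * c) ≡ ∑ n h * c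
  ∑-distribʳ-* h c zero = refl
  ∑-distribʳ-* h c (suc n) = trans (cong (_+ h (suc n) * c) (∑-distribʳ-* h c n)) (sym (*-distribʳ-+ c (∑ n h) _))

  term≤∑ : ∀ (h : ℕ → ℕ) {n k} → 1 ≤ k → k ≤ n → h k ≤ ∑ n h
  term≤∑ h {zero} (s≤s z≤n) ()
  term≤∑ h {suc n} 1≤k k≤1+n with m≤n⇒m<n∨m≡n k≤1+n
  ... | inj₁ k<1+n = ≤-trans (term≤∑ h {n} 1≤k (<⇒≤pred k<1+n)) (m≤m+n _ _)
  ... | inj₂ refl = m≤n+m _ _

  term≤max : ∀ (h : ℕ → ℕ) {n k} → 1 ≤ k → k ≤ n → h k ≤ max n h
  term≤max h {zero} (s≤s z≤n) ()
  term≤max h {suc n} 1≤k k≤1+n with m≤n⇒m<n∨m≡n k≤1+n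
  ... | inj₁ k<1+n = ≤-trans (term≤max h {n} 1≤k (<⇒≤pred k<1+n)) (m≤m⊔n _ _)
  ... | inj₂ refl = m≤n⊔m _ _

  ∑-extend-≤ : ∀ {h : ℕ → ℕ} → (∀ k → h k ≤ 1) → ∀ d m → ∑ (d + m) h ≤ d + ∑ m h
  ∑-extend-≤ h≤1 zero m = ≤-refl
  ∑-extend-≤ {h} h≤1 (suc d) m = begin
    ∑ (d + m) h + h (suc (d + m)) ≤⟨ +-mono-≤ (∑-extend-≤ h≤1 d m) (h≤1 _) ⟩
    d + ∑ m h + 1                 ≡⟨ +-comm _ 1 ⟩
    suc (d + ∑ m h)               ∎
    where open ≤-Reasoning

  module Gaps (F : ℕ → ℕ) {H : Pred ℕ 0ℓ} (H? : Decidable H)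
              (H⊆image : ∀ {n} → H n → ∃[ k ] n ≡ suc k + F (suc k)) where

    hits : ℕ → ℕ
    hits m = ∑[ n ≤ m ] 𝟙 (H? n)

    gaps : ℕ → ℕ
    gaps N = N ∸ hits N

    -- For k ≤ m, m ∸ k < F k says that k + F k > m, and F k ≡ suc m ∸ k that k + F k = m + 1.
    pending : ℕ → ℕ
    pending m = ∑[ k ≤ m ] 𝟙 (m ∸ k <? F k)

    arrivals : ℕ → ℕ
    arrivals m = ∑[ k ≤ m ] 𝟙 (F k ≟ suc m ∸ k)

    pending-suc : ∀ m → pending (suc m) + arrivals m ≡ pending m + 𝟙 (0 <? F (suc m))
    pending-suc m = begin
      still + 𝟙 (m ∸ m <? F (suc m)) + arrivals m ≡⟨ cong (λ d → still + 𝟙 (d <? F (suc m)) + arrivals m) (n∸n≡0 m) ⟩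
      still + 𝟙 (0 <? F (suc m)) + arrivals m     ≡⟨ xy∙z≈xz∙y still _ _ ⟩
      still + arrivals m + 𝟙 (0 <? F (suc m))     ≡⟨ cong (_+ 𝟙 (0 <? F (suc m))) (sym split) ⟩
      pending m + 𝟙 (0 <? F (suc m))              ∎
      where
      open ≡-Reasoning
      still : ℕ
      still = ∑[ k ≤ m ] 𝟙 (suc m ∸ k <? F k)
      split : pending m ≡ still + arrivals m
      split = trans (∑-cong m λ {k} _ k≤m → subst (λ d → 𝟙 (m ∸ k <? F k) ≡ 𝟙 (d <? F k) + 𝟙 (F k ≟ d))
                                                   (sym (+-∸-assoc 1 k≤m)) ([m<n]≡[1+m<n]+[n≡1+m] (m ∸ k) (F k)))
                    (∑-distrib-+ m)

    image⇒F≡0⊎arrival : ∀ {j m} → m ≡ j + F (suc j) → F (suc m) ≡ 0 ⊎ 1 ≤ arrivals m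
    image⇒F≡0⊎arrival {j} {m} m≡j+F with m≤n⇒m<n∨m≡n (m+n≤o⇒m≤o j (≤-reflexive (sym m≡j+F)))
    ... | inj₂ refl = inj₁ (sym (+-cancelˡ-≡ j 0 (F (suc j)) (trans (+-identityʳ j) m≡j+F)))
    ... | inj₁ j<m = inj₂ (subst (_≤ arrivals m) arrives (term≤∑ (λ k → 𝟙 (F k ≟ suc m ∸ k)) (s≤s z≤n) j<m))
      where
      arrives : 𝟙 (F (suc j) ≟ m ∸ j) ≡ 1
      arrives = 𝟙-yes (F (suc j) ≟ m ∸ j) (sym (trans (cong (_∸ j) m≡j+F) (m+n∸m≡n j (F (suc j)))))

    hit⇒F≡0⊎arrival : ∀ {m} → H (suc m) → F (suc m) ≡ 0 ⊎ 1 ≤ arrivals m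
    hit⇒F≡0⊎arrival hit with H⊆image hit
    ... | _ , 1+m≡1+j+F = image⇒F≡0⊎arrival (suc-injective 1+m≡1+j+F)

    hit-step : ∀ m → 𝟙 (H? (suc m)) + 𝟙 (0 <? F (suc m)) ≤ 1 + arrivals m
    hit-step m with H? (suc m)
    ... | no _ = ≤-trans (𝟙≤1 (0 <? F (suc m))) (m≤m+n 1 (arrivals m))
    ... | yes hit with hit⇒F≡0⊎arrival hit
    ...   | inj₁ F≡0 rewrite F≡0 = s≤s z≤n
    ...   | inj₂ 1≤arrivals = s≤s (≤-trans (𝟙≤1 (0 <? F (suc m))) 1≤arrivals)

    hits+pending≤ : ∀ m → hits m + pending m ≤ m
    hits+pending≤ zero = z≤n
    hits+pending≤ (suc m) = +-cancelʳ-≤ (arrivals m) _ _ (begin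
      hits m + hit + pending (suc m) + arrivals m   ≡⟨ +-assoc (hits m + hit) _ _ ⟩
      hits m + hit + (pending (suc m) + arrivals m) ≡⟨ cong (hits m + hit +_) (pending-suc m) ⟩
      hits m + hit + (pending m + starts)           ≡⟨ +-interchange (hits m) hit (pending m) starts ⟩
      hits m + pending m + (hit + starts)           ≤⟨ +-mono-≤ (hits+pending≤ m) (hit-step m) ⟩
      m + (1 + arrivals m)                          ≡⟨ +-suc m (arrivals m) ⟩
      suc m + arrivals m                            ∎)
      where
      open ≤-Reasoning
      hit starts : ℕ
      hit = 𝟙 (H? (suc m))
      starts = 𝟙 (0 <? F (suc m))

    hits≤ : ∀ m → hits m ≤ m
    hits≤ m = ≤-trans (m≤m+n (hits m) (pending m)) (hits+pending≤ m)

    pending≤gaps : ∀ {m N} → m ≤ N → pending m ≤ gaps N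
    pending≤gaps {m} {N} m≤N = m+n≤o⇒m≤o∸n (pending m) (begin
      pending m + hits N                 ≡⟨ cong (λ n → pending m + hits n) (sym (m∸n+n≡m m≤N)) ⟩
      pending m + hits (N ∸ m + m)       ≤⟨ +-monoʳ-≤ (pending m) (∑-extend-≤ (λ n → 𝟙≤1 (H? n)) (N ∸ m) m) ⟩
      pending m + (N ∸ m + hits m)       ≡⟨ x∙yz≈y∙zx (pending m) (N ∸ m) (hits m) ⟩
      N ∸ m + (hits m + pending m)       ≤⟨ +-monoʳ-≤ (N ∸ m) (hits+pending≤ m) ⟩
      N ∸ m + m                          ≡⟨ m∸n+n≡m m≤N ⟩
      N                                  ∎)
      where open ≤-Reasoning

    -- ∑_{k ≤ n} min(n − k, F k) counts the pairs k ≤ m < n with k pending at m, i.e. it is ∑_{m < n} pending m.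
    truncated : ℕ → ℕ
    truncated n = ∑[ k ≤ n ] ((n ∸ k) ⊓ F k)

    truncated-suc : ∀ n → truncated (suc n) ≡ truncated n + pending n
    truncated-suc n = begin
      ∑[ k ≤ n ] ((suc n ∸ k) ⊓ F k) + (n ∸ n) ⊓ F (suc n)
        ≡⟨ cong₂ _+_ (∑-cong n shift) (cong (_⊓ F (suc n)) (n∸n≡0 n)) ⟩
      ∑[ k ≤ n ] ((n ∸ k) ⊓ F k + 𝟙 (n ∸ k <? F k)) + 0
        ≡⟨ +-identityʳ _ ⟩
      ∑[ k ≤ n ] ((n ∸ k) ⊓ F k + 𝟙 (n ∸ k <? F k))
        ≡⟨ ∑-distrib-+ n ⟩
      truncated n + pending n
        ∎
      where
      open ≡-Reasoning
      shift : ∀ {k} → 1 ≤ k → k ≤ n → (suc n ∸ k) ⊓ F k ≡ (n ∸ k) ⊓ F k + 𝟙 (n ∸ k <? F k)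
      shift {k} _ k≤n = trans (cong (_⊓ F k) (+-∸-assoc 1 k≤n)) (1+m⊓n≡m⊓n+[m<n] (n ∸ k) (F k))

    truncated≤ : ∀ {n N} → n ≤ N → truncated n ≤ n * gaps N
    truncated≤ {zero} _ = z≤n
    truncated≤ {suc n} {N} n<N = begin
      truncated (suc n)       ≡⟨ truncated-suc n ⟩
      truncated n + pending n ≤⟨ +-mono-≤ (truncated≤ (<⇒≤ n<N)) (pending≤gaps (<⇒≤ n<N)) ⟩
      n * gaps N + gaps N     ≡⟨ +-comm (n * gaps N) (gaps N) ⟩
      suc n * gaps N          ∎
      where open ≤-Reasoning

    excess≤ : ∀ N → ∑[ k ≤ N ] (F k ∸ (N ∸ k)) ≤ pending N * max[ k ≤ N ] F k
    excess≤ N = begin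
      ∑[ k ≤ N ] (F k ∸ (N ∸ k))       ≤⟨ ∑-mono-≤ N excess-term ⟩
      ∑[ k ≤ N ] (𝟙 (N ∸ k <? F k) * D) ≡⟨ ∑-distribʳ-* (λ k → 𝟙 (N ∸ k <? F k)) D N ⟩
      pending N * D                    ∎
      where
      open ≤-Reasoning
      D : ℕ
      D = max[ k ≤ N ] F k
      excess-term : ∀ {k} → 1 ≤ k → k ≤ N → F k ∸ (N ∸ k) ≤ 𝟙 (N ∸ k <? F k) * D
      excess-term 1≤k k≤N = m≤o⇒m∸n≤[n<m]*o (term≤max F 1≤k k≤N)

    ∑≤gaps*[N+max] : ∀ N → ∑[ k ≤ N ] F k ≤ gaps N * (N + max[ k ≤ N ] F k)
    ∑≤gaps*[N+max] N = begin
      ∑[ k ≤ N ] F k                                   ≡⟨ ∑-cong N (λ {k} _ _ → sym (m⊓n+n∸m≡n (N ∸ k) (F k))) ⟩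
      ∑[ k ≤ N ] ((N ∸ k) ⊓ F k + (F k ∸ (N ∸ k)))     ≡⟨ ∑-distrib-+ N ⟩
      truncated N + ∑[ k ≤ N ] (F k ∸ (N ∸ k))         ≤⟨ +-mono-≤ (truncated≤ (≤-refl {N})) (excess≤ N) ⟩
      N * gaps N + pending N * D                        ≤⟨ +-monoʳ-≤ (N * gaps N) (*-monoˡ-≤ D (pending≤gaps (≤-refl {N}))) ⟩
      N * gaps N + gaps N * D                           ≡⟨ cong (_+ gaps N * D) (*-comm N (gaps N)) ⟩
      gaps N * N + gaps N * D                           ≡⟨ *-distribˡ-+ (gaps N) N D ⟨
      gaps N * (N + D)                                  ∎
      where
      open ≤-Reasoning
      D : ℕ
      D = max[ k ≤ N ] F k

  [1‥suc] : ∀ m → [1‥ suc m ] ≡ [1‥ m ] ++ [ suc m ]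
  [1‥suc] m = trans (cong (map suc) (sym (upTo-∷ʳ m))) (map-++ suc (upTo m) [ m ])

  length-filter-[_] : ∀ {P : Pred ℕ 0ℓ} (P? : Decidable P) n → length (filter P? [ n ]) ≡ 𝟙 (P? n)
  length-filter-[ P? ] n with does (P? n)
  ... | true = refl
  ... | false = refl

  length-filter-[1‥] : ∀ {P : Pred ℕ 0ℓ} (P? : Decidable P) m → length (filter P? [1‥ m ]) ≡ ∑[ n ≤ m ] 𝟙 (P? n)
  length-filter-[1‥] P? zero = refl
  length-filter-[1‥] P? (suc m) = begin
    length (filter P? [1‥ suc m ])                           ≡⟨ cong (length ∘ filter P?) ([1‥suc] m) ⟩
    length (filter P? ([1‥ m ] ++ [ suc m ]))                ≡⟨ cong length (filter-++ P? [1‥ m ] [ suc m ]) ⟩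
    length (filter P? [1‥ m ] ++ filter P? [ suc m ])        ≡⟨ length-++ (filter P? [1‥ m ]) ⟩
    length (filter P? [1‥ m ]) + length (filter P? [ suc m ]) ≡⟨ cong₂ _+_ (length-filter-[1‥] P? m) (length-filter-[ P? ] (suc m)) ⟩
    ∑[ n ≤ suc m ] 𝟙 (P? n)                                  ∎
    where open ≡-Reasoning

  foldr-+-shift : ∀ xs a → foldr ℤ._+_ a xs ≡ foldr ℤ._+_ (ℤ.+ 0) xs ℤ.+ a
  foldr-+-shift [] a = sym (ℤ.+-identityˡ a)
  foldr-+-shift (y ∷ xs) a = trans (cong (ℤ._+_ y) (foldr-+-shift xs a)) (sym (ℤ.+-assoc y _ a))

  sumF-suc : ∀ f n → sumF f (suc n) ≡ sumF f n ℤ.+ f (suc n)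
  sumF-suc f n = begin
    foldr ℤ._+_ (ℤ.+ 0) (map f [1‥ suc n ])                     ≡⟨ cong (foldr ℤ._+_ (ℤ.+ 0) ∘ map f) ([1‥suc] n) ⟩
    foldr ℤ._+_ (ℤ.+ 0) (map f ([1‥ n ] ++ [ suc n ]))           ≡⟨ cong (foldr ℤ._+_ (ℤ.+ 0)) (map-++ f [1‥ n ] [ suc n ]) ⟩
    foldr ℤ._+_ (ℤ.+ 0) (map f [1‥ n ] ++ [ f (suc n) ])         ≡⟨ foldr-++ ℤ._+_ (ℤ.+ 0) (map f [1‥ n ]) [ f (suc n) ] ⟩
    foldr ℤ._+_ (f (suc n) ℤ.+ ℤ.+ 0) (map f [1‥ n ])            ≡⟨ foldr-+-shift (map f [1‥ n ]) _ ⟩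
    sumF f n ℤ.+ (f (suc n) ℤ.+ ℤ.+ 0)                           ≡⟨ cong (ℤ._+_ (sumF f n)) (ℤ.+-identityʳ (f (suc n))) ⟩
    sumF f n ℤ.+ f (suc n)                                     ∎
    where open ≡-Reasoning

  module _ {f : ℕ → ℤ} {F : ℕ → ℕ} (f≡+F : ∀ k → 1 ≤ k → f k ≡ ℤ.+ F k) where

    sumF≡∑ : ∀ n → sumF f n ≡ ℤ.+ ∑[ k ≤ n ] F k
    sumF≡∑ zero = refl
    sumF≡∑ (suc n) = begin
      sumF f (suc n)              ≡⟨ sumF-suc f n ⟩
      sumF f n ℤ.+ f (suc n)      ≡⟨ cong₂ ℤ._+_ (sumF≡∑ n) (f≡+F (suc n) (s≤s z≤n)) ⟩
      ℤ.+ (∑ n F + F (suc n))       ∎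
      where open ≡-Reasoning

    value? : ∀ N n → Dec (Any (λ k → ℤ.+ n ≡ ℤ.+ k ℤ.+ f k) [1‥ N ])
    value? N n = any? (λ k → ℤ.+ n ℤ.≟ ℤ.+ k ℤ.+ f k) [1‥ N ]

    value⇒image : ∀ {N n} → Any (λ k → ℤ.+ n ≡ ℤ.+ k ℤ.+ f k) [1‥ N ] → ∃[ k ] n ≡ suc k + F (suc k)
    value⇒image v with satisfied (map⁻ v)
    ... | j , n≡1+j+f = j , ℤ.+-injective (trans n≡1+j+f (cong (ℤ._+_ (ℤ.+ suc j)) (f≡+F (suc j) (s≤s z≤n))))

    count≡hits : ∀ N → count f N ≡ Gaps.hits F (value? N) value⇒image N
    count≡hits N = length-filter-[1‥] (value? N) N

open Counting

open import Data.Nat as ℕ using (ℕ; zero; suc; z≤n; s≤s)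
import Data.Nat.Properties as ℕ
import Data.Nat.Coprimality as Coprime
open import Data.Integer as ℤ using (ℤ; +_; -[1+_]; +≤+)
import Data.Integer.Properties as ℤ
import Data.Integer.DivMod as ℤ
open import Data.Product using (_×_; proj₁; proj₂)
open import Data.Sum using (inj₁; inj₂)
open import Data.Rational as ℚ using (ℚ; 0ℚ; 1ℚ; _+_; _*_; _-_; _≤_; _<_; mkℚ; *≤*; nonNegative)
import Data.Rational.Properties as ℚ
open import Data.Rational.Solver using (module +-*-Solver)
open import Relation.Binary.PropositionalEquality

toℚ : ℕ → ℚ
toℚ n = ℤ→ℚ (+ n)

toℚ≡mkℚ : ∀ n → toℚ n ≡ mkℚ (+ n) 0 (Coprime.sym (Coprime.1-coprimeTo n))
toℚ≡mkℚ n = ℚ.normalize-coprime (Coprime.sym (Coprime.1-coprimeTo n))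

toℚ-mono-≤ : ∀ {m n} → m ℕ.≤ n → toℚ m ≤ toℚ n
toℚ-mono-≤ {m} {n} m≤n rewrite toℚ≡mkℚ m | toℚ≡mkℚ n =
  *≤* (subst₂ ℤ._≤_ (sym (ℤ.*-identityʳ (+ m))) (sym (ℤ.*-identityʳ (+ n))) (+≤+ m≤n))

toℚ-nonNeg : ∀ n → 0ℚ ≤ toℚ n
toℚ-nonNeg n = toℚ-mono-≤ {0} {n} z≤n

toℚ-homo-+ : ∀ m n → toℚ (m ℕ.+ n) ≡ toℚ m + toℚ n
toℚ-homo-+ m n rewrite toℚ≡mkℚ m | toℚ≡mkℚ n =
  cong (ℚ._/ 1) (cong₂ ℤ._+_ (sym (ℤ.*-identityʳ (+ m))) (sym (ℤ.*-identityʳ (+ n))))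

toℚ-homo-* : ∀ m n → toℚ (m ℕ.* n) ≡ toℚ m * toℚ n
toℚ-homo-* m n rewrite toℚ≡mkℚ m | toℚ≡mkℚ n = cong (ℚ._/ 1) (ℤ.pos-* m n)

toℚ-⌊⌋ℕ≤ : ∀ {x} → 0ℚ ≤ x → toℚ ⌊ x ⌋ℕ ≤ x
toℚ-⌊⌋ℕ≤ {x@(mkℚ (+ n) d-1 _)} _ rewrite toℚ≡mkℚ ⌊ x ⌋ℕ =
  *≤* (subst₂ ℤ._≤_ (cong (ℤ._* + suc d-1) (sym +⌊x⌋≡n/d)) (sym (ℤ.*-identityʳ (+ n)))
                    (ℤ.[n/d]*d≤n (+ n) (+ suc d-1)))
  where
  +⌊x⌋≡n/d : + ⌊ x ⌋ℕ ≡ + n ℤ./ + suc d-1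
  +⌊x⌋≡n/d = ℤ.0≤i⇒+∣i∣≡i (ℤ.0≤n⇒0≤n/d (+ n) (+ suc d-1) (+≤+ z≤n) (+≤+ z≤n))
toℚ-⌊⌋ℕ≤ {mkℚ -[1+ _ ] _ _} (*≤* ())

toℚ-max≤ : ∀ {c} {h : ℕ → ℕ} → 0ℚ ≤ c → (∀ k → 1 ℕ.≤ k → toℚ (h k) ≤ c * toℚ k) →
           ∀ n → toℚ (max[ k ≤ n ] h k) ≤ c * toℚ n
toℚ-max≤ {c} _ _ zero = ℚ.≤-reflexive (sym (ℚ.*-zeroʳ c))
toℚ-max≤ {c} {h} 0≤c h≤c* (suc n) with ℕ.⊔-sel (max[ k ≤ n ] h k) (h (suc n))
... | inj₁ max≡ rewrite max≡ = ℚ.≤-trans (toℚ-max≤ 0≤c h≤c* n) (ℚ.*-monoˡ-≤-nonNeg c {{nonNegative 0≤c}} (toℚ-mono-≤ (ℕ.n≤1+n n)))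
... | inj₂ max≡ rewrite max≡ = h≤c* (suc n) (s≤s z≤n)

open +-*-Solver

*-mono-≤-nonNeg : ∀ {p q r s} → 0ℚ ≤ p → 0ℚ ≤ r → p ≤ q → r ≤ s → p * r ≤ q * s
*-mono-≤-nonNeg {p} {q} {r} {s} 0≤p 0≤r p≤q r≤s =
  ℚ.≤-trans (ℚ.*-monoˡ-≤-nonNeg p {{nonNegative 0≤p}} r≤s)
            (ℚ.*-monoʳ-≤-nonNeg s {{nonNegative (ℚ.≤-trans 0≤r r≤s)}} p≤q)

toℚ-m≤x-n : ∀ {m n N x} → m ℕ.+ n ≡ N → toℚ N ≤ x → toℚ m ≤ x - toℚ n
toℚ-m≤x-n {m} {n} {N} {x} m+n≡N N≤x = begin
  toℚ m                   ≡⟨ solve 2 (λ a b → a := a :+ b :- b) refl (toℚ m) (toℚ n) ⟩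
  toℚ m + toℚ n - toℚ n   ≡⟨ cong (_- toℚ n) (trans (sym (toℚ-homo-+ m n)) (cong toℚ m+n≡N)) ⟩
  toℚ N - toℚ n           ≤⟨ ℚ.+-monoˡ-≤ (ℚ.- toℚ n) N≤x ⟩
  x - toℚ n               ∎
  where open ℚ.≤-Reasoning

N+D≤[2c+2]x : ∀ {c N D x} → 0ℚ ≤ c → toℚ D ≤ c * toℚ N → toℚ N ≤ x →
              toℚ (N ℕ.+ D) ≤ ((1ℚ + 1ℚ) * c + (1ℚ + 1ℚ)) * x
N+D≤[2c+2]x {c} {N} {D} {x} 0≤c D≤cN N≤x = begin
  toℚ (N ℕ.+ D)                   ≡⟨ toℚ-homo-+ N D ⟩
  toℚ N + toℚ D                   ≤⟨ ℚ.+-monoʳ-≤ (toℚ N) D≤cN ⟩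
  toℚ N + c * toℚ N               ≡⟨ solve 2 (λ n c → n :+ c :* n := (con 1ℚ :+ c) :* n) refl (toℚ N) c ⟩
  (1ℚ + c) * toℚ N                ≤⟨ ℚ.*-monoˡ-≤-nonNeg (1ℚ + c) {{nonNegative 0≤1+c}} N≤x ⟩
  (1ℚ + c) * x                    ≡⟨ ℚ.+-identityʳ _ ⟨
  (1ℚ + c) * x + 0ℚ               ≤⟨ ℚ.+-monoʳ-≤ ((1ℚ + c) * x) 0≤[1+c]x ⟩
  (1ℚ + c) * x + (1ℚ + c) * x     ≡⟨ solve 2 (λ c x → (con 1ℚ :+ c) :* x :+ (con 1ℚ :+ c) :* x
                                                    := ((con 1ℚ :+ con 1ℚ) :* c :+ (con 1ℚ :+ con 1ℚ)) :* x) refl c x ⟩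
  ((1ℚ + 1ℚ) * c + (1ℚ + 1ℚ)) * x ∎
  where
  open ℚ.≤-Reasoning
  0≤1+c : 0ℚ ≤ 1ℚ + c
  0≤1+c = ℚ.+-mono-≤ (ℚ.<⇒≤ (ℚ.positive⁻¹ 1ℚ)) 0≤c
  0≤[1+c]x : 0ℚ ≤ (1ℚ + c) * x
  0≤[1+c]x = ℚ.nonNegative⁻¹ _ {{ℚ.nonNeg*nonNeg⇒nonNeg (1ℚ + c) {{nonNegative 0≤1+c}} x
                                   {{nonNegative (ℚ.≤-trans (toℚ-nonNeg N) N≤x)}}}}

theorem3 : (c : ℚ) → 0ℚ < c → (f : ℕ → ℤ) →
    (∀ k → 1 ℕ.≤ k → (+ 0 ℤ.≤ f k) × (ℤ→ℚ (f k) ≤ c * ℤ→ℚ (+ k))) →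
    (x : ℚ) → 0ℚ < x →
    ℤ→ℚ (sumF f ⌊ x ⌋ℕ) ≤ (x - ℤ→ℚ (+ count f ⌊ x ⌋ℕ)) * (((1ℚ + 1ℚ) * c + (1ℚ + 1ℚ)) * x)
theorem3 c 0<c f f-bounds x 0<x = begin
  ℤ→ℚ (sumF f N)                         ≡⟨ cong ℤ→ℚ (sumF≡∑ f≡+F N) ⟩
  toℚ (∑[ k ≤ N ] F k)                    ≤⟨ toℚ-mono-≤ (∑≤gaps*[N+max] N) ⟩
  toℚ (gaps N ℕ.* (N ℕ.+ D))              ≡⟨ toℚ-homo-* (gaps N) (N ℕ.+ D) ⟩
  toℚ (gaps N) * toℚ (N ℕ.+ D)            ≤⟨ *-mono-≤-nonNeg (toℚ-nonNeg (gaps N)) (toℚ-nonNeg (N ℕ.+ D)) gaps≤ N+D≤ ⟩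
  (x - toℚ (count f N)) * (((1ℚ + 1ℚ) * c + (1ℚ + 1ℚ)) * x) ∎
  where
  open ℚ.≤-Reasoning
  N : ℕ
  N = ⌊ x ⌋ℕ
  F : ℕ → ℕ
  F k = ℤ.∣ f k ∣
  f≡+F : ∀ k → 1 ℕ.≤ k → f k ≡ + F k
  f≡+F k 1≤k = sym (ℤ.0≤i⇒+∣i∣≡i (proj₁ (f-bounds k 1≤k)))
  open Gaps F (value? f≡+F N) (value⇒image f≡+F)
  D : ℕ
  D = max[ k ≤ N ] F k
  0≤c : 0ℚ ≤ c
  0≤c = ℚ.<⇒≤ 0<c
  N≤x : toℚ N ≤ x
  N≤x = toℚ-⌊⌋ℕ≤ (ℚ.<⇒≤ 0<x)
  gaps≤ : toℚ (gaps N) ≤ x - toℚ (count f N)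
  gaps≤ = toℚ-m≤x-n {gaps N} {count f N} (trans (cong (gaps N ℕ.+_) (count≡hits f≡+F N)) (ℕ.m∸n+n≡m (hits≤ N))) N≤x
  F≤ck : ∀ k → 1 ℕ.≤ k → toℚ (F k) ≤ c * toℚ k
  F≤ck k 1≤k = subst (λ z → ℤ→ℚ z ≤ c * toℚ k) (f≡+F k 1≤k) (proj₂ (f-bounds k 1≤k))
  N+D≤ : toℚ (N ℕ.+ D) ≤ ((1ℚ + 1ℚ) * c + (1ℚ + 1ℚ)) * x
  N+D≤ = N+D≤[2c+2]x {N = N} {D} 0≤c (toℚ-max≤ 0≤c F≤ck N) N≤x
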